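{- Let $\mathfrak{D} = \langle \mathfrak{M}, \star\rangle$ be a class of dynamic models. The following axiom schemata are valid in $\mathfrak{D}$, for all $n \in \mathbb{N}$, $\varphi \in \mathcal{L}_0$, and $\xi \in\mathcal{L}_\leq(\star)$, if $\star$ is $\mathfrak{M}$-LC-compliant: $$ \begin{array}{lcll} {} [\star \varphi][\leq] \xi &\rightarrow &\displaystyle\bigwedge_{i=1}^{n}\bigwedge_{j=i}^{n} \mu dg_{\varphi}(j) \rightarrow A (\mu dg_{\varphi}(i)\rightarrow [\star \varphi]\xi) \wedge\\ &&\displaystyle\bigwedge_{i=1}^{n}\bigwedge_{j=i}^{n} \mu dg_{\neg \varphi}(j) \rightarrow A (\mu dg_{\neg \varphi}(i)\rightarrow [\star \varphi]\xi) \wedge\\ &&\displaystyle\bigwedge_{i=1}^{n}\bigwedge_{j=i}^{n} \mu dg_\varphi(j) \rightarrow A (\mu dg_{\neg \varphi}(i)\rightarrow [\star \varphi]\xi) \wedge\\ &&\displaystyle\bigwedge_{i=1}^{n} \bigwedge_{j=i}^{n} \mu dg_{\neg \varphi(j)} \rightarrow A (\mu dg_{\varphi}(i)\rightarrow [\star \varphi]\xi)\\ {} [\star \varphi][<] \xi &\rightarrow &\displaystyle\bigwedge_{i=1}^{n}\bigwedge_{j=i+1}^{n} \mu dg_{\varphi}(j) \rightarrow A (\mu dg_{\varphi}(i)\rightarrow [\star \varphi]\xi) \wedge\\ &&\displaystyle\bigwedge_{i=1}^{n}\bigwedge_{j=i+1}^{n} \mu dg_{\neg \varphi}(j) \rightarrow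 A (\mu dg_{\neg \varphi}(i)\rightarrow [\star \varphi]\xi) \wedge\\ &&\displaystyle\bigwedge_{i=1}^{n}\bigwedge_{j=i+1}^{n} \mu dg_\varphi(j) \rightarrow A (\mu dg_{\neg \varphi}(i)\rightarrow [\star \varphi]\xi) \wedge\\ &&\displaystyle\bigwedge_{i=1}^{n} \bigwedge_{j=i+1}^{n} \mu dg_{\neg \varphi}(j) \rightarrow A (\mu dg_{\varphi}(i)\rightarrow [\star \varphi]\xi)\\ {} [\star \varphi][\leq] \xi &\leftarrow & (\mu dg_{\neg\varphi}(n) \vee \mu dg_\varphi(n))\wedge \displaystyle\bigwedge_{i=1}^{n} A (\mu dg_{\varphi}(i)\rightarrow [\star \varphi]\xi) \wedge \\ &&\displaystyle\bigwedge_{i=1}^{n} A (\mu dg_{\neg \varphi}(i)\rightarrow [\star \varphi]\xi)\\ {} [\star \varphi][<] \xi &\leftarrow & (\mu dg_{\neg\varphi}(n) \vee \mu dg_\varphi(n))\wedge\displaystyle\bigwedge_{i=1}^{n-1} A (\mu dg_{\varphi}(i)\rightarrow [\star \varphi]\xi) \wedge\\ &&\displaystyle\bigwedge_{i=1}^{n-1} A (\mu dg_{\neg \varphi}(i)\rightarrow [\star \varphi]\xi) \end{array}$$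
   Context: Fix a set $P$ of propositional letters; $\mathcal{L}_0$ is the classical propositional language over $P$. A (well-founded) preference model is $M=\langle W,\leq,v\rangle$ with $W$ a set of worlds, $\leq$ a reflexive, transitive relation on $W$ whose strict part $<$ is well-founded, and $v:P\to 2^W$ a valuation; $\mathit{Mod}(\mathcal{L}_\leq)$ is the class of all such models. A dynamic operator is a map $\star:\mathit{Mod}(\mathcal{L}_\leq)\times\mathcal{L}_0\to\mathit{Mod}(\mathcal{L}_\leq)$ with $\star(M,\varphi)=\langle W,\leq_{\star\varphi},v\rangle$ (same worlds and valuation). The language $\mathcal{L}_\leq(\star)$ is built from $P$ with $\neg,\wedge$, the universal modality $A$, the modalities $[\leq]$, $[<]$ (dual $\langle<\rangle$), and formulas $[\star\varphi]\xi$ with $\varphi\in\mathcal{L}_0$. A dynamic model is $D=\langle M,\star\rangle$, with $D,w\vDash A\xi$ iff every world satisfies $\xi$, $D,w\vDash[\leq]\xi$ iff every $w'\leq w$ satisfies $\xi$, $D,w\vDash[<]\xi$ iff every $w'<w$ satisfies $\xi$, and $D,w\vDash[\star\varphi]\xi$ iff $\langle\star(M,\varphi),\star\rangle,w\vDash\xi$. For a class $\mathfrak{M}$ of preference models over which $\star$ is closed, $\mathfrak{D}=\langle\mathfrak{M},\star\rangle$ is the class of dynamic models $\langle M,\star\rangle$ with $M\in\mathfrak{M}$; a formula is valid in $\mathfrak{D}$ if it is true at every world of every such model. $[\![\varphi]\!]$ denotes the set of worlds of the model under consideration satisfying $\varphi$. $\mu\varphi := \varphi\wedge\neg\langle<\rangle\varphi$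 (true exactly at the $\leq$-minimal $\varphi$-worlds). $dg_\varphi(1)=\varphi$ and $dg_\varphi(i)=\varphi\wedge\langle<\rangle dg_\varphi(i-1)$ for $i>1$; $w$ satisfies $\mu\, dg_\varphi(i)$ iff the maximal length of a $<$-chain of $\varphi$-worlds ending in $w$ is $i$. $\star$ is $\mathfrak{M}$-LC-compliant if for every $M=\langle W,\leq,v\rangle\in\mathfrak{M}$, every $\varphi\in\mathcal{L}_0$ and all $w,w'\in W$, with $D=\langle M,\star\rangle$: (LC') for $\xi,\chi\in\{\varphi,\neg\varphi\}$ (not necessarily distinct), if $D,w\vDash\xi$ and $D,w'\vDash\chi$, then $w\leq_{\star\varphi}w'$ iff the maximal length of a chain of worlds in $[\![\xi]\!]$ ending in $w$ is less than or equal to the maximal length of a chain of worlds in $[\![\chi]\!]$ ending in $w'$. -}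

module Defs where

open import Level using (0ℓ)
open import Data.Nat using (ℕ; zero; suc; _+_; _∸_)
open import Data.Bool using (Bool; true; false)
open import Data.List using (List; []; _∷_; map; foldr; upTo)
open import Data.Product using (_×_; _,_)
open import Data.Unit using (⊤)
open import Data.Empty using (⊥)
open import Relation.Nullary using (¬_)
open import Relation.Binary using (Rel)
open import Induction.WellFounded using (WellFounded)
open import Function.Bundles using (_⇔_)

data L0 (P : Set) : Set where
  var₀ : P → L0 P
  ¬₀_  : L0 P → L0 P
  _∧₀_ : L0 P → L0 P → L0 P

-- The language L≤(★)
-- (⊤ᶠ is an extra constant used only for empty big conjunctions.)

data Form (P : Set) : Set where
  var  : P → Form P
  ⊤ᶠ   : Form P
  ¬ᶠ_  : Form P → Form P
  _∧ᶠ_ : Form P → Form P → Form P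
  A    : Form P → Form P
  [≤]  : Form P → Form P
  [<]  : Form P → Form P
  [★_]_ : L0 P → Form P → Form P

embed : {P : Set} → L0 P → Form P
embed (var₀ p) = var p
embed (¬₀ φ) = ¬ᶠ embed φ
embed (φ ∧₀ ψ) = embed φ ∧ᶠ embed ψ

_⇒ᶠ_ : {P : Set} → Form P → Form P → Form P
a ⇒ᶠ b = ¬ᶠ (a ∧ᶠ (¬ᶠ b))

_∨ᶠ_ : {P : Set} → Form P → Form P → Form P
a ∨ᶠ b = ¬ᶠ ((¬ᶠ a) ∧ᶠ (¬ᶠ b))

⟨<⟩ : {P : Set} → Form P → Form P
⟨<⟩ a = ¬ᶠ [<] (¬ᶠ a)

μ : {P : Set} → Form P → Form P
μ a = a ∧ᶠ (¬ᶠ ⟨<⟩ a)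

-- dg_φ(1) = φ, dg_φ(i) = φ ∧ ⟨<⟩ dg_φ(i-1).
-- dg φ 0 is a junk value (φ ∧ ¬φ) and is never used by the statement.
dg : {P : Set} → L0 P → ℕ → Form P
dg φ zero = embed φ ∧ᶠ (¬ᶠ embed φ)
dg φ (suc zero) = embed φ
dg φ (suc (suc k)) = embed φ ∧ᶠ ⟨<⟩ (dg φ (suc k))

range : ℕ → ℕ → List ℕ
range a b = map (a +_) (upTo (suc b ∸ a))

⋀ : {P : Set} → ℕ → ℕ → (ℕ → Form P) → Form P
⋀ a b f = foldr _∧ᶠ_ ⊤ᶠ (map f (range a b))

Strict : {W : Set} → Rel W 0ℓ → Rel W 0ℓ
Strict _≤_ x y = x ≤ y × ¬ (y ≤ x)

record Pref (W : Set) : Set₁ where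
  field
    _≤_   : Rel W 0ℓ
    refl  : ∀ w → w ≤ w
    trans : ∀ {u v w} → u ≤ v → v ≤ w → u ≤ w
    wf    : WellFounded (Strict _≤_)

record Model (P : Set) (W : Set) : Set₁ where
  field
    pref : Pref W
    val  : P → W → Set
  open Pref pref public
  _<_ : Rel W 0ℓ
  _<_ = Strict _≤_

Op : Set → Set₁
Op P = ∀ {W : Set} → Model P W → L0 P → Pref W

update : {P W : Set} → Op P → Model P W → L0 P → Model P W
update ★ M φ = record { pref = ★ M φ ; val = Model.val M }

Class : Set → Set₁
Class P = ∀ {W : Set} → Model P W → Set

Closed : {P : Set} → Class P → Op P → Set₁
Closed {P} 𝔐 ★ = ∀ {W : Set} (M : Model P W) (φ : L0 P) → 𝔐 M → 𝔐 (update ★ M φ)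

sat₀ : {P W : Set} → (P → W → Set) → L0 P → W → Set
sat₀ v (var₀ p) w = v p w
sat₀ v (¬₀ φ) w = ¬ sat₀ v φ w
sat₀ v (φ ∧₀ ψ) w = sat₀ v φ w × sat₀ v ψ w

sat : {P W : Set} → Op P → Model P W → Form P → W → Set
sat ★ M (var p) w = Model.val M p w
sat ★ M ⊤ᶠ w = ⊤
sat ★ M (¬ᶠ ξ) w = ¬ sat ★ M ξ w
sat ★ M (ξ ∧ᶠ χ) w = sat ★ M ξ w × sat ★ M χ w
sat ★ M (A ξ) w = ∀ w' → sat ★ M ξ w'
sat ★ M ([≤] ξ) w = ∀ w' → Model._≤_ M w' w → sat ★ M ξ w'
sat ★ M ([<] ξ) w = ∀ w' → Model._<_ M w' w → sat ★ M ξ w'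
sat ★ M ([★ φ ] ξ) w = sat ★ (update ★ M φ) ξ w

Valid : {P : Set} → Class P → Op P → Form P → Set₁
Valid {P} 𝔐 ★ ξ = ∀ {W : Set} (M : Model P W) → 𝔐 M → ∀ w → sat ★ M ξ w

data Chain {W : Set} (_<_ : Rel W 0ℓ) (S : W → Set) : W → ℕ → Set where
  one  : ∀ {w} → S w → Chain _<_ S w 1
  step : ∀ {w w' k} → S w → w' < w → Chain _<_ S w' k → Chain _<_ S w (suc k)

-- "the maximal length of a chain of S-worlds ending in w is ≤ the maximal
-- length of a chain of T-worlds ending in w'": every length attained at w
-- is attained at w' (comparison of the suprema in ℕ ∪ {∞}; the sets of
-- attained lengths are downward closed).
MaxLen≤ : {W : Set} → Rel W 0ℓ → (W → Set) → W → (W → Set) → W → Set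
MaxLen≤ _<_ S w T w' = ∀ k → Chain _<_ S w k → Chain _<_ T w' k

lit : {P : Set} → Bool → L0 P → L0 P
lit true φ = φ
lit false φ = ¬₀ φ

LCCompliant : {P : Set} → Class P → Op P → Set₁
LCCompliant {P} 𝔐 ★ =
  ∀ {W : Set} (M : Model P W) → 𝔐 M → ∀ (φ : L0 P) (w w' : W) (b c : Bool) →
  sat₀ (Model.val M) (lit b φ) w → sat₀ (Model.val M) (lit c φ) w' →
  (Pref._≤_ (★ M φ) w w' ⇔
    MaxLen≤ (Model._<_ M) (sat₀ (Model.val M) (lit b φ)) w
                          (sat₀ (Model.val M) (lit c φ)) w')

block : {P : Set} → ℕ → ℕ → L0 P → L0 P → L0 P → Form P → Form P
block d n φ α β ξ =
  ⋀ 1 n (λ i → ⋀ (i + d) n (λ j →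
    μ (dg α j) ⇒ᶠ A (μ (dg β i) ⇒ᶠ ([★ φ ] ξ))))

blocks : {P : Set} → ℕ → ℕ → L0 P → Form P → Form P
blocks d n φ ξ =
  block d n φ φ φ ξ ∧ᶠ (block d n φ (¬₀ φ) (¬₀ φ) ξ ∧ᶠ
  (block d n φ φ (¬₀ φ) ξ ∧ᶠ block d n φ (¬₀ φ) φ ξ))

ax≤⇒ : {P : Set} → ℕ → L0 P → Form P → Form P
ax≤⇒ n φ ξ = ([★ φ ] [≤] ξ) ⇒ᶠ blocks 0 n φ ξ

ax<⇒ : {P : Set} → ℕ → L0 P → Form P → Form P
ax<⇒ n φ ξ = ([★ φ ] [<] ξ) ⇒ᶠ blocks 1 n φ ξ

premise : {P : Set} → ℕ → ℕ → L0 P → Form P → Form P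
premise n m φ ξ =
  (μ (dg (¬₀ φ) n) ∨ᶠ μ (dg φ n)) ∧ᶠ
  (⋀ 1 m (λ i → A (μ (dg φ i) ⇒ᶠ ([★ φ ] ξ))) ∧ᶠ
   ⋀ 1 m (λ i → A (μ (dg (¬₀ φ) i) ⇒ᶠ ([★ φ ] ξ))))

ax≤⇐ : {P : Set} → ℕ → L0 P → Form P → Form P
ax≤⇐ n φ ξ = premise n n φ ξ ⇒ᶠ ([★ φ ] [≤] ξ)

ax<⇐ : {P : Set} → ℕ → L0 P → Form P → Form P
ax<⇐ n φ ξ = premise n (n ∸ 1) φ ξ ⇒ᶠ ([★ φ ] [<] ξ)

-- Write ht_α(w) for the maximal length of a <-chain of α-worlds ending in w. Classically,
-- μ dg_α(k) holds at w exactly when ht_α(w) = k, so LC-compliance says that after the update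
-- by φ a φ-world or ¬φ-world v lies below w iff ht(v) ≤ ht(w), and strictly below iff
-- ht(v) < ht(w). For the ⇐ schemata, if w has height n then
-- every v below it has a height k ≤ n (k < n for strictly below), which the premise covers.
module Submission where

open import Defs
open import Level using (0ℓ)
open import Data.Nat using (ℕ; zero; suc; _+_; _∸_; _≤_; _<_; z≤n; s≤s; _≤?_)
open import Data.Nat.Properties
  using (≤-refl; ≤-trans; ≤-reflexive; ≤-pred; <⇒≤; <⇒≱; ≰⇒>; +-comm; m≤n⇒m≤1+n; m≤m+n; m+n≤o⇒m≤o;
         m+[n∸m]≡n; ∸-monoˡ-<)
open import Data.Bool using (Bool; true; false)
open import Data.List using ([]; _∷_; map; foldr)
open import Data.List.Membership.Propositional using (_∈_)
open import Data.List.Membership.Propositional.Properties using (∈-map⁺; ∈-map⁻; ∈-upTo⁺; ∈-upTo⁻)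
open import Data.List.Relation.Unary.All as All using (All; []; _∷_)
open import Data.Product using (_×_; _,_; proj₁; ∃-syntax; ∃₂)
open import Data.Sum using (_⊎_; inj₁; inj₂)
open import Data.Empty using (⊥-elim)
open import Data.Unit using (tt)
open import Relation.Nullary using (¬_; yes; no; contradiction)
open import Relation.Binary using (Rel)
open import Relation.Binary.PropositionalEquality using (_≡_; refl; cong; cong₂; subst; sym)
open import Function using (id)
open import Function.Bundles using (_⇔_; mk⇔; Equivalence)
open import Axiom.ExcludedMiddle using (ExcludedMiddle)
open import Axiom.DoubleNegationElimination using (em⇒dne)

open Equivalence using (to; from)

k<1+b∸a⇒a+k≤b : ∀ a k b → k < suc b ∸ a → a + k ≤ b
k<1+b∸a⇒a+k≤b zero k b k<1+b = ≤-pred k<1+b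
k<1+b∸a⇒a+k≤b (suc a) k (suc b) k<1+b∸a = s≤s (k<1+b∸a⇒a+k≤b a k b k<1+b∸a)
k<1+b∸a⇒a+k≤b (suc zero) k zero ()
k<1+b∸a⇒a+k≤b (suc (suc a)) k zero ()

∈-range⁻ : ∀ {a b i} → i ∈ range a b → a ≤ i × i ≤ b
∈-range⁻ {a} {b} i∈ with k , k∈ , refl ← ∈-map⁻ (a +_) i∈ =
  m≤m+n a k , k<1+b∸a⇒a+k≤b a k b (∈-upTo⁻ k∈)

∈-range⁺ : ∀ {a b i} → a ≤ i → i ≤ b → i ∈ range a b
∈-range⁺ {a} {b} a≤i i≤b =
  subst (_∈ range a b) (m+[n∸m]≡n a≤i) (∈-map⁺ (a +_) (∈-upTo⁺ (∸-monoˡ-< (s≤s i≤b) a≤i)))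

Height : {W : Set} → Rel W 0ℓ → (W → Set) → W → ℕ → Set
Height _<_ S w k = Chain _<_ S w k × ¬ Chain _<_ S w (suc k)

module _ {W : Set} {_≺_ : Rel W 0ℓ} where

  chain-head : ∀ {S w k} → Chain _≺_ S w k → S w
  chain-head (one s) = s
  chain-head (step s _ _) = s

  chain-lower : ∀ {S w j k} → Chain _≺_ S w k → suc j ≤ k → Chain _≺_ S w (suc j)
  chain-lower (one s) (s≤s z≤n) = one s
  chain-lower (step s _ _) (s≤s z≤n) = one s
  chain-lower (step s w′≺w c) (s≤s (s≤s j≤k)) = step s w′≺w (chain-lower c (s≤s j≤k))

  chain-length≤height : ∀ {S w i k} → Height _≺_ S w i → Chain _≺_ S w k → k ≤ i
  chain-length≤height {i = i} {k = suc k} (_ , ¬c) c with suc k ≤? i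
  ... | yes k<i = k<i
  ... | no k≮i = contradiction (chain-lower c (≰⇒> k≮i)) ¬c

  height-≤⇒MaxLen≤ : ∀ {S T u v i j} → Height _≺_ S u i → Height _≺_ T v j → i ≤ j →
                     MaxLen≤ _≺_ S u T v
  height-≤⇒MaxLen≤ hu (cv , _) i≤j (suc k) c =
    chain-lower cv (≤-trans (chain-length≤height hu c) i≤j)

  MaxLen≤⇒height-≤ : ∀ {S T u v i j} → Height _≺_ S u i → Height _≺_ T v j →
                     MaxLen≤ _≺_ S u T v → i ≤ j
  MaxLen≤⇒height-≤ (cu , _) hv le = chain-length≤height hv (le _ cu)

  height-within : ExcludedMiddle 0ℓ → ∀ {S w} m → S w → ¬ Chain _≺_ S w (suc m) →
                  ∃[ k ] (1 ≤ k × k ≤ m × Height _≺_ S w k)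
  height-within em zero s ¬c = contradiction (one s) ¬c
  height-within em {S} {w} (suc m) s ¬c with em {Chain _≺_ S w (suc m)}
  ... | yes c = suc m , s≤s z≤n , ≤-refl , c , ¬c
  ... | no ¬c′ with k , 1≤k , k≤m , h ← height-within em m s ¬c′ =
    k , 1≤k , m≤n⇒m≤1+n k≤m , h

module Semantics (em : ExcludedMiddle 0ℓ) {P : Set} (★ : Op P) {W : Set} (M : Model P W) where

  open Model M using (val) renaming (_<_ to _≺_)

  infix 4 _⊩_
  _⊩_ : W → Form P → Set
  w ⊩ ξ = sat ★ M ξ w

  ⊩-embed : ∀ α w → (w ⊩ embed α) ≡ sat₀ val α w
  ⊩-embed (var₀ p) w = refl
  ⊩-embed (¬₀ α) w = cong ¬_ (⊩-embed α w)
  ⊩-embed (α ∧₀ β) w = cong₂ _×_ (⊩-embed α w) (⊩-embed β w)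

  ⊩-⇒⁺ : ∀ a b {w} → (w ⊩ a → w ⊩ b) → w ⊩ (a ⇒ᶠ b)
  ⊩-⇒⁺ a b f (x , ¬y) = ¬y (f x)

  ⊩-⇒⁻ : ∀ a b {w} → w ⊩ (a ⇒ᶠ b) → w ⊩ a → w ⊩ b
  ⊩-⇒⁻ a b a⇒b x = em⇒dne em (λ ¬y → a⇒b (x , ¬y))

  ⊩-∨⁻ : ∀ a b {w} → w ⊩ (a ∨ᶠ b) → w ⊩ a ⊎ w ⊩ b
  ⊩-∨⁻ a b {w} a∨b with em {w ⊩ a} | em {w ⊩ b}
  ... | yes x | _ = inj₁ x
  ... | no _ | yes y = inj₂ y
  ... | no ¬x | no ¬y = ⊥-elim (a∨b (¬x , ¬y))

  ⊩-⟨<⟩ : ∀ {a w} → w ⊩ ⟨<⟩ a ⇔ (∃[ w′ ] (w′ ≺ w × w′ ⊩ a))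
  ⊩-⟨<⟩ = mk⇔
    (λ ◇a → em⇒dne em (λ ∄ → ◇a (λ w′ w′≺w x → ∄ (w′ , w′≺w , x))))
    (λ { (w′ , w′≺w , x) □¬a → □¬a w′ w′≺w x })

  ⊩-dg : ∀ α k {w} → w ⊩ dg α k ⇔ Chain _≺_ (sat₀ val α) w k
  ⊩-dg α k = mk⇔ (dg⇒chain k) (chain⇒dg k)
    where
    dg⇒chain : ∀ k {w} → w ⊩ dg α k → Chain _≺_ (sat₀ val α) w k
    dg⇒chain zero (x , ¬x) = contradiction x ¬x
    dg⇒chain (suc zero) {w} x = one (subst id (⊩-embed α w) x)
    dg⇒chain (suc (suc k)) {w} (x , ◇d) =
      let w′ , w′≺w , d = to (⊩-⟨<⟩ {dg α (suc k)}) ◇d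
      in step (subst id (⊩-embed α w) x) w′≺w (dg⇒chain (suc k) d)

    chain⇒dg : ∀ k {w} → Chain _≺_ (sat₀ val α) w k → w ⊩ dg α k
    chain⇒dg (suc zero) {w} (one s) = subst id (sym (⊩-embed α w)) s
    chain⇒dg (suc zero) (step _ _ ())
    chain⇒dg (suc (suc k)) {w} (step s w′≺w c) =
      subst id (sym (⊩-embed α w)) s , from (⊩-⟨<⟩ {dg α (suc k)}) (_ , w′≺w , chain⇒dg (suc k) c)

  ⊩-μdg : ∀ α k {w} → w ⊩ μ (dg α k) ⇔ Height _≺_ (sat₀ val α) w k
  ⊩-μdg α k = mk⇔
    (λ { (d , ¬◇d) → to (⊩-dg α k) d , no-longer d ¬◇d })
    (λ { (c , ¬c) → from (⊩-dg α k) c , λ ◇d →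
           let w′ , w′≺w , d = to (⊩-⟨<⟩ {dg α k}) ◇d
           in ¬c (step (chain-head c) w′≺w (to (⊩-dg α k) d)) })
    where
    no-longer : ∀ {w} → w ⊩ dg α k → ¬ w ⊩ ⟨<⟩ (dg α k) → ¬ Chain _≺_ (sat₀ val α) w (suc k)
    no-longer d ¬◇d (one _) = contradiction (to (⊩-dg α zero) d) λ ()
    no-longer d ¬◇d (step _ w′≺w c) = ¬◇d (from (⊩-⟨<⟩ {dg α k}) (_ , w′≺w , from (⊩-dg α k) c))

  ⊩-⋀-All : ∀ {w} (f : ℕ → Form P) xs → w ⊩ foldr _∧ᶠ_ ⊤ᶠ (map f xs) ⇔ All (λ i → w ⊩ f i) xs
  ⊩-⋀-All f xs = mk⇔ (conj⇒All xs) (All⇒conj xs)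
    where
    conj⇒All : ∀ {w} xs → w ⊩ foldr _∧ᶠ_ ⊤ᶠ (map f xs) → All (λ i → w ⊩ f i) xs
    conj⇒All [] _ = []
    conj⇒All (x ∷ xs) (fx , rest) = fx ∷ conj⇒All xs rest

    All⇒conj : ∀ {w} xs → All (λ i → w ⊩ f i) xs → w ⊩ foldr _∧ᶠ_ ⊤ᶠ (map f xs)
    All⇒conj [] [] = tt
    All⇒conj (x ∷ xs) (fx ∷ rest) = fx , All⇒conj xs rest

  ⊩-⋀⁺ : ∀ a b f {w} → (∀ i → a ≤ i → i ≤ b → w ⊩ f i) → w ⊩ ⋀ a b f
  ⊩-⋀⁺ a b f h =
    from (⊩-⋀-All f (range a b)) (All.tabulate λ i∈ → let a≤i , i≤b = ∈-range⁻ i∈ in h _ a≤i i≤b)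

  ⊩-⋀⁻ : ∀ a b f {w} → w ⊩ ⋀ a b f → ∀ i → a ≤ i → i ≤ b → w ⊩ f i
  ⊩-⋀⁻ a b f conj i a≤i i≤b = All.lookup (to (⊩-⋀-All f (range a b)) conj) (∈-range⁺ a≤i i≤b)

module Compliant (em : ExcludedMiddle 0ℓ) {P : Set} (𝔐 : Class P) (★ : Op P) (lc : LCCompliant 𝔐 ★)
                 {W : Set} (M : Model P W) (M∈𝔐 : 𝔐 M) (φ : L0 P) where

  open Model M using (val) renaming (_<_ to _≺_)
  open Semantics em ★ M

  _≤★_ : Rel W 0ℓ
  _≤★_ = Pref._≤_ (★ M φ)

  Lit : Bool → W → Set
  Lit b = sat₀ val (lit b φ)

  HeightIn : Bool → W → ℕ → Set
  HeightIn b = Height _≺_ (Lit b)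

  ≤★⇔height-≤ : ∀ b c {u v i j} → HeightIn b u i → HeightIn c v j → u ≤★ v ⇔ i ≤ j
  ≤★⇔height-≤ b c hu hv = mk⇔
    (λ u≤v → MaxLen≤⇒height-≤ hu hv (to LC u≤v))
    (λ i≤j → from LC (height-≤⇒MaxLen≤ hu hv i≤j))
    where LC = lc M M∈𝔐 φ _ _ b c (chain-head (proj₁ hu)) (chain-head (proj₁ hv))

  height-<⇒<★ : ∀ b c {u v i j} → HeightIn b u i → HeightIn c v j → i < j → Strict _≤★_ u v
  height-<⇒<★ b c hu hv i<j =
    from (≤★⇔height-≤ b c hu hv) (<⇒≤ i<j) , λ v≤u → <⇒≱ i<j (to (≤★⇔height-≤ c b hv hu) v≤u)

  literal : ∀ v → ∃[ c ] Lit c v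
  literal v with em {sat₀ val φ v}
  ... | yes x = true , x
  ... | no ¬x = false , ¬x

  height-below : ∀ b {w v n} → HeightIn b w n → v ≤★ w →
                 ∃₂ λ c k → 1 ≤ k × k ≤ n × HeightIn c v k
  height-below b {w} {v} {n} (cw , ¬cw) v≤w with c , x ← literal v
    with k , 1≤k , k≤n , hv ← height-within em n x
           (λ cv → ¬cw (to (lc M M∈𝔐 φ v w c b x (chain-head cw)) v≤w (suc n) cv)) =
    c , k , 1≤k , k≤n , hv

  height-strictly-below : ∀ b {w v n} → HeightIn b w n → Strict _≤★_ v w →
                          ∃₂ λ c k → 1 ≤ k × k < n × HeightIn c v k
  height-strictly-below b hw (v≤w , w≰v) with c , k , 1≤k , _ , hv ← height-below b hw v≤w =
    c , k , 1≤k , ≰⇒> (λ n≤k → w≰v (from (≤★⇔height-≤ b c hw hv) n≤k)) , hv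

module Schemata (em : ExcludedMiddle 0ℓ) {P : Set} (𝔐 : Class P) (★ : Op P) (lc : LCCompliant 𝔐 ★)
                {W : Set} (M : Model P W) (M∈𝔐 : 𝔐 M) (φ : L0 P) (ξ : Form P) (w : W) where

  open Semantics em ★ M
  open Compliant em 𝔐 ★ lc M M∈𝔐 φ

  ⊩-blocks : ∀ d n →
             (∀ b c {i j v} → i + d ≤ j → HeightIn b w j → HeightIn c v i → v ⊩ ([★ φ ] ξ)) →
             w ⊩ blocks d n φ ξ
  ⊩-blocks d n H = ⊩-block true true , ⊩-block false false , ⊩-block true false , ⊩-block false true
    where
    ⊩-block : ∀ b c → w ⊩ block d n φ (lit b φ) (lit c φ) ξ
    ⊩-block b c = ⊩-⋀⁺ 1 n _ λ i _ _ → ⊩-⋀⁺ (i + d) n _ λ j i+d≤j _ →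
      λ { (μj , ¬□) → ¬□ λ v → λ { (μi , ¬ξ) →
        ¬ξ (H b c i+d≤j (to (⊩-μdg (lit b φ) j) μj) (to (⊩-μdg (lit c φ) i) μi)) } }

  premise-height : ∀ n m → w ⊩ premise n m φ ξ → ∃[ b ] HeightIn b w n
  premise-height n m (ht , _) with ⊩-∨⁻ (μ (dg (¬₀ φ) n)) (μ (dg φ n)) ht
  ... | inj₁ μ¬φ = false , to (⊩-μdg (¬₀ φ) n) μ¬φ
  ... | inj₂ μφ = true , to (⊩-μdg φ n) μφ

  premise-covers : ∀ n m → w ⊩ premise n m φ ξ →
                   ∀ c {i v} → 1 ≤ i → i ≤ m → HeightIn c v i → v ⊩ ([★ φ ] ξ)
  premise-covers n m (_ , covφ , _) true {i} 1≤i i≤m hv =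
    ⊩-⇒⁻ (μ (dg φ i)) ([★ φ ] ξ) (⊩-⋀⁻ 1 m _ covφ _ 1≤i i≤m _) (from (⊩-μdg φ _) hv)
  premise-covers n m (_ , _ , cov¬φ) false {i} 1≤i i≤m hv =
    ⊩-⇒⁻ (μ (dg (¬₀ φ) i)) ([★ φ ] ξ) (⊩-⋀⁻ 1 m _ cov¬φ _ 1≤i i≤m _) (from (⊩-μdg (¬₀ φ) _) hv)

  ⊩-ax≤⇒ : ∀ n → w ⊩ ax≤⇒ n φ ξ
  ⊩-ax≤⇒ n = ⊩-⇒⁺ ([★ φ ] [≤] ξ) (blocks 0 n φ ξ) λ □ξ → ⊩-blocks 0 n λ b c {i} i+0≤j hw hv →
    □ξ _ (from (≤★⇔height-≤ c b hv hw) (m+n≤o⇒m≤o i i+0≤j))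

  ⊩-ax<⇒ : ∀ n → w ⊩ ax<⇒ n φ ξ
  ⊩-ax<⇒ n = ⊩-⇒⁺ ([★ φ ] [<] ξ) (blocks 1 n φ ξ) λ □ξ → ⊩-blocks 1 n λ b c {i} i+1≤j hw hv →
    □ξ _ (height-<⇒<★ c b hv hw (≤-trans (≤-reflexive (+-comm 1 i)) i+1≤j))

  ⊩-ax≤⇐ : ∀ n → w ⊩ ax≤⇐ n φ ξ
  ⊩-ax≤⇐ n = ⊩-⇒⁺ (premise n n φ ξ) ([★ φ ] [≤] ξ) λ pr v v≤w →
    let b , hw = premise-height n n pr
        c , k , 1≤k , k≤n , hv = height-below b hw v≤w
    in premise-covers n n pr c 1≤k k≤n hv

  ⊩-ax<⇐ : ∀ {n} → 1 ≤ n → w ⊩ ax<⇐ n φ ξ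
  ⊩-ax<⇐ {suc n} _ = ⊩-⇒⁺ (premise (suc n) n φ ξ) ([★ φ ] [<] ξ) λ pr v v<w →
    let b , hw = premise-height (suc n) n pr
        c , k , 1≤k , k<1+n , hv = height-strictly-below b hw v<w
    in premise-covers (suc n) n pr c 1≤k (≤-pred k<1+n) hv

proposition47 : ExcludedMiddle 0ℓ → (P : Set) (𝔐 : Class P) (★ : Op P) →
    Closed 𝔐 ★ → LCCompliant 𝔐 ★ →
    ∀ (n : ℕ) (φ : L0 P) (ξ : Form P) →
    Valid 𝔐 ★ (ax≤⇒ n φ ξ) × Valid 𝔐 ★ (ax<⇒ n φ ξ) ×
    (1 ≤ n → Valid 𝔐 ★ (ax≤⇐ n φ ξ)) × (1 ≤ n → Valid 𝔐 ★ (ax<⇐ n φ ξ))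
proposition47 em P 𝔐 ★ _ lc n φ ξ =
    (λ M M∈𝔐 w → Schemata.⊩-ax≤⇒ em 𝔐 ★ lc M M∈𝔐 φ ξ w n)
  , (λ M M∈𝔐 w → Schemata.⊩-ax<⇒ em 𝔐 ★ lc M M∈𝔐 φ ξ w n)
  , (λ _ M M∈𝔐 w → Schemata.⊩-ax≤⇐ em 𝔐 ★ lc M M∈𝔐 φ ξ w n)
  , (λ 1≤n M M∈𝔐 w → Schemata.⊩-ax<⇐ em 𝔐 ★ lc M M∈𝔐 φ ξ w 1≤n)
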